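{- Let $M=M(S_0,\dots,S_r)$ be a freedom matroid on a finite linearly ordered set $S$, where each $S_i$ is an initial segment of $S$, and let $\rho$ be its rank function. Let $A\subseteq S$, $a\in A$, and $b\in S\setminus A$ with $b>a$. Then $\rho((A\setminus a)\cup b)\ge\rho(A)$.
   Context: A flag on $S$ is a sequence $(S_0,\dots,S_r)$ with $S_r=S$ and $S_{i-1}\subsetneq S_i$; the freedom matroid $M(S_0,\dots,S_r)$ has as independent sets the $I\subseteq S$ with $|I\cap S_i|\le i$ for all $i$. An initial segment of $S$ is a subset closed downward in the order of $S$. -}

module Defs where

open import Data.Nat as ℕ using (ℕ; zero; suc; _≤_; _⊔_)
open import Data.Nat.Properties using (_≤?_)
open import Data.Fin as Fin using (Fin; toℕ; fromℕ; inject₁)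
import Data.Fin.Properties as FinP
open import Data.Fin.Subset using (Subset; _∈_; _⊆_; _⊂_; _∩_; ∣_∣; ⊤; inside; outside)
open import Data.Fin.Subset.Properties using (_⊆?_)
open import Data.Vec using (_∷_; [])
open import Data.List using (List; []; _∷_; map; _++_; filter; foldr)
open import Relation.Nullary using (Dec)
open import Relation.Nullary.Decidable using (_×-dec_)
open import Data.Product using (_×_)
open import Relation.Binary.PropositionalEquality using (_≡_)

record Flag (n r : ℕ) : Set where
  field
    F      : Fin (suc r) → Subset n
    top    : F (fromℕ r) ≡ ⊤
    strict : (i : Fin r) → F (inject₁ i) ⊂ F (Fin.suc i)
open Flag public

InitialSegment : {n : ℕ} → Subset n → Set
InitialSegment {n} X = (x y : Fin n) → y Fin.≤ x → x ∈ X → y ∈ X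

Independent : {n r : ℕ} → Flag n r → Subset n → Set
Independent {r = r} fl I = (i : Fin (suc r)) → ∣ I ∩ F fl i ∣ ≤ toℕ i

independent? : {n r : ℕ} (fl : Flag n r) (I : Subset n) → Dec (Independent fl I)
independent? fl I = FinP.all? (λ i → ∣ I ∩ F fl i ∣ ≤? toℕ i)

allSubsets : (n : ℕ) → List (Subset n)
allSubsets zero    = [] ∷ []
allSubsets (suc n) = map (outside ∷_) (allSubsets n) ++ map (inside ∷_) (allSubsets n)

maximum : List ℕ → ℕ
maximum = foldr _⊔_ 0

rank : {n r : ℕ} → Flag n r → Subset n → ℕ
rank {n} fl X =
  maximum (map ∣_∣ (filter (λ I → (I ⊆? X) ×-dec independent? fl I) (allSubsets n)))

-- An independent set I ⊆ A of maximal size either avoids a, and then already lies in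
-- (A - a) ∪ {b}, or contains a, and then (I - a) ∪ {b} is a set of the same size in
-- (A - a) ∪ {b}. The latter is still independent: every S_i is an initial segment, so
-- b ∈ S_i forces a ∈ S_i, and trading a for b never increases |I ∩ S_i|.
module Submission where

open import Defs
open import Data.Nat using (ℕ; suc; _≤_)
open import Data.Fin using (Fin; _<_)
open import Data.Fin.Subset using (Subset; _∈_; _∉_; _∪_; _-_; ⁅_⁆)

open import Data.Nat using (z≤n; s≤s; _⊔_)
open import Data.Nat.Properties using (≤-refl; ≤-trans; ≤-reflexive; n≤1+n; m≤m⊔n; m≤n⊔m; ⊔-identityʳ; ⊔-sel; <⇒≤)
import Data.Fin as Fin
open import Data.Fin.Properties using () renaming (_≟_ to _≟ᶠ_)
open import Data.Fin.Subset using (_⊆_; _∩_; _─_; ∣_∣; ⊥; inside; outside)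
open import Data.Fin.Subset.Properties
open import Data.Vec using (_∷_; []; here; there)
open import Data.List using (map; filter) renaming (_∷_ to _∷ₗ_; [] to []ₗ)
open import Data.List.Membership.Propositional using () renaming (_∈_ to _∈ₗ_)
open import Data.List.Membership.Propositional.Properties using (∈-++⁺ˡ; ∈-++⁺ʳ; ∈-map⁺; ∈-map⁻; ∈-filter⁺; ∈-filter⁻)
import Data.List.Relation.Unary.Any as Any
open import Data.Product using (_×_; _,_; ∃)
open import Data.Sum using (_⊎_; inj₁; inj₂; [_,_])
open import Function using (_∘_)
open import Relation.Nullary using (Dec; yes; no; contradiction)
open import Relation.Nullary.Decidable using (_×-dec_)
open import Relation.Binary.PropositionalEquality using (_≡_; refl; sym; trans; cong; subst)

private
  variable
    n : ℕ
    p q s : Subset n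
    x y : Fin n

x∈p─q⇒x∉q : ∀ (p q : Subset n) → x ∈ p ─ q → x ∉ q
x∈p─q⇒x∉q                (inside  ∷ p) (outside ∷ q) here        ()
x∈p─q⇒x∉q {x = Fin.zero} (outside ∷ p) (outside ∷ q) ()
x∈p─q⇒x∉q {x = Fin.zero} (_       ∷ p) (inside  ∷ q) ()
x∈p─q⇒x∉q                (_       ∷ p) (_       ∷ q) (there x∈p) = x∈p─q⇒x∉q p q x∈p ∘ drop-there

p⊆q∧x∉p⇒p⊆q-x : p ⊆ q → x ∉ p → p ⊆ q - x
p⊆q∧x∉p⇒p⊆q-x p⊆q x∉p {z} z∈p = x∈p∧x≢y⇒x∈p-y (p⊆q z∈p) λ { refl → x∉p z∈p }

p⊆q⇒p-x∪⁅y⁆⊆q-x∪⁅y⁆ : p ⊆ q → (p - x) ∪ ⁅ y ⁆ ⊆ (q - x) ∪ ⁅ y ⁆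
p⊆q⇒p-x∪⁅y⁆⊆q-x∪⁅y⁆ {p = p} {x = x} {y = y} p⊆q =
  [ x∈p∪q⁺ ∘ inj₁ ∘ mono-─ , x∈p∪q⁺ ∘ inj₂ ] ∘ x∈p∪q⁻ (p - x) ⁅ y ⁆
  where
  mono-─ : p - x ⊆ _ - x
  mono-─ z∈p-x = x∈p∧x∉q⇒x∈p─q (p⊆q (p─q⊆p p ⁅ x ⁆ z∈p-x)) (x∈p─q⇒x∉q p ⁅ x ⁆ z∈p-x)

∣p∪⁅x⁆∣≤1+∣p∣ : ∀ (p : Subset n) x → ∣ p ∪ ⁅ x ⁆ ∣ ≤ suc ∣ p ∣
∣p∪⁅x⁆∣≤1+∣p∣ (outside ∷ p) Fin.zero    rewrite ∪-identityʳ p = ≤-refl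
∣p∪⁅x⁆∣≤1+∣p∣ (inside  ∷ p) Fin.zero    rewrite ∪-identityʳ p = n≤1+n _
∣p∪⁅x⁆∣≤1+∣p∣ (outside ∷ p) (Fin.suc x) = ∣p∪⁅x⁆∣≤1+∣p∣ p x
∣p∪⁅x⁆∣≤1+∣p∣ (inside  ∷ p) (Fin.suc x) = s≤s (∣p∪⁅x⁆∣≤1+∣p∣ p x)

∣p∣≤1+∣p-x∣ : ∀ (p : Subset n) x → ∣ p ∣ ≤ suc ∣ p - x ∣
∣p∣≤1+∣p-x∣ p x = ≤-trans (p⊆q⇒∣p∣≤∣q∣ p⊆p-x∪⁅x⁆) (∣p∪⁅x⁆∣≤1+∣p∣ (p - x) x)
  where
  p⊆p-x∪⁅x⁆ : p ⊆ (p - x) ∪ ⁅ x ⁆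
  p⊆p-x∪⁅x⁆ {z} z∈p with z ≟ᶠ x
  ... | yes refl = x∈p∪q⁺ (inj₂ (x∈⁅x⁆ z))
  ... | no z≢x   = x∈p∪q⁺ (inj₁ (x∈p∧x≢y⇒x∈p-y z∈p z≢x))

y∉p⇒∣p∣≤∣p-x∪⁅y⁆∣ : y ∉ p → ∣ p ∣ ≤ ∣ (p - x) ∪ ⁅ y ⁆ ∣
y∉p⇒∣p∣≤∣p-x∪⁅y⁆∣ {y = y} {p = p} {x = x} y∉p =
  ≤-trans (∣p∣≤1+∣p-x∣ p x)
          (p⊂q⇒∣p∣<∣q∣ (p⊆p∪q ⁅ y ⁆ , y , x∈p∪q⁺ (inj₂ (x∈⁅x⁆ y)) , y∉p ∘ p─q⊆p p ⁅ x ⁆))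

∣p-x∪⁅y⁆∩s∣≤∣p∩s∣ : x ∈ p → (y ∈ s → x ∈ s) → ∣ ((p - x) ∪ ⁅ y ⁆) ∩ s ∣ ≤ ∣ p ∩ s ∣
∣p-x∪⁅y⁆∩s∣≤∣p∩s∣ {x = x} {p = p} {y = y} {s = s} x∈p y∈s⇒x∈s with y ∈? s
... | yes y∈s =
  ≤-trans (p⊆q⇒∣p∣≤∣q∣ ⊆p∩s-x∪⁅y⁆)
          (≤-trans (∣p∪⁅x⁆∣≤1+∣p∣ ((p ∩ s) - x) y) (x∈p⇒∣p-x∣<∣p∣ (x∈p∩q⁺ (x∈p , y∈s⇒x∈s y∈s))))
  where
  ⊆p∩s-x∪⁅y⁆ : ((p - x) ∪ ⁅ y ⁆) ∩ s ⊆ ((p ∩ s) - x) ∪ ⁅ y ⁆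
  ⊆p∩s-x∪⁅y⁆ z∈ with x∈p∩q⁻ _ s z∈
  ... | z∈p-x∪⁅y⁆ , z∈s with x∈p∪q⁻ (p - x) ⁅ y ⁆ z∈p-x∪⁅y⁆
  ...   | inj₁ z∈p-x = x∈p∪q⁺ (inj₁ (x∈p∧x∉q⇒x∈p─q (x∈p∩q⁺ (p─q⊆p p ⁅ x ⁆ z∈p-x , z∈s))
                                                    (x∈p─q⇒x∉q p ⁅ x ⁆ z∈p-x)))
  ...   | inj₂ z∈⁅y⁆ = x∈p∪q⁺ (inj₂ z∈⁅y⁆)
... | no y∉s = p⊆q⇒∣p∣≤∣q∣ ⊆p∩s
  where
  ⊆p∩s : ((p - x) ∪ ⁅ y ⁆) ∩ s ⊆ p ∩ s
  ⊆p∩s z∈ with x∈p∩q⁻ _ s z∈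
  ... | z∈p-x∪⁅y⁆ , z∈s with x∈p∪q⁻ (p - x) ⁅ y ⁆ z∈p-x∪⁅y⁆
  ...   | inj₁ z∈p-x = x∈p∩q⁺ (p─q⊆p p ⁅ x ⁆ z∈p-x , z∈s)
  ...   | inj₂ z∈⁅y⁆ = contradiction (subst (_∈ s) (x∈⁅y⁆⇒x≡y y z∈⁅y⁆) z∈s) y∉s

maximum-upperBound : ∀ {m} ms → m ∈ₗ ms → m ≤ maximum ms
maximum-upperBound (m ∷ₗ ms) (Any.here refl) = m≤m⊔n m (maximum ms)
maximum-upperBound (k ∷ₗ ms) (Any.there m∈ms) = ≤-trans (maximum-upperBound ms m∈ms) (m≤n⊔m k (maximum ms))

maximum-attained : ∀ ms → maximum ms ≡ 0 ⊎ maximum ms ∈ₗ ms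
maximum-attained []ₗ = inj₁ refl
maximum-attained (m ∷ₗ ms) with maximum-attained ms | ⊔-sel m (maximum ms)
... | inj₁ max≡0  | _           = inj₂ (Any.here (trans (cong (m ⊔_) max≡0) (⊔-identityʳ m)))
... | inj₂ _       | inj₁ m⊔≡m   = inj₂ (Any.here m⊔≡m)
... | inj₂ max∈ms | inj₂ m⊔≡max = inj₂ (Any.there (subst (_∈ₗ ms) (sym m⊔≡max) max∈ms))

∈-allSubsets : ∀ (p : Subset n) → p ∈ₗ allSubsets n
∈-allSubsets []            = Any.here refl
∈-allSubsets (outside ∷ p) = ∈-++⁺ˡ (∈-map⁺ (outside ∷_) (∈-allSubsets p))
∈-allSubsets {suc n} (inside ∷ p) =
  ∈-++⁺ʳ (map (outside ∷_) (allSubsets n)) (∈-map⁺ (inside ∷_) (∈-allSubsets p))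

module _ {r : ℕ} (fl : Flag n r) where

  independent-⊥ : Independent fl ⊥
  independent-⊥ i rewrite ∩-zeroˡ (F fl i) | ∣⊥∣≡0 n = z≤n

  independent-exchange : ((i : Fin (suc r)) → InitialSegment (F fl i)) →
    Independent fl p → x ∈ p → x Fin.≤ y → Independent fl ((p - x) ∪ ⁅ y ⁆)
  independent-exchange segments p-indep x∈p x≤y i =
    ≤-trans (∣p-x∪⁅y⁆∩s∣≤∣p∩s∣ x∈p (segments i _ _ x≤y)) (p-indep i)

  independentSubset? : ∀ (X p : Subset n) → Dec (p ⊆ X × Independent fl p)
  independentSubset? X p = (p ⊆? X) ×-dec independent? fl p

  independent⇒∣p∣≤rank : ∀ (X : Subset n) → p ⊆ X → Independent fl p → ∣ p ∣ ≤ rank fl X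
  independent⇒∣p∣≤rank {p} X p⊆X p-indep = maximum-upperBound _
    (∈-map⁺ ∣_∣ (∈-filter⁺ (independentSubset? X) (∈-allSubsets p) (p⊆X , p-indep)))

  rank-attained : ∀ (X : Subset n) → ∃ λ I → I ⊆ X × Independent fl I × rank fl X ≡ ∣ I ∣
  rank-attained X with maximum-attained (map ∣_∣ (filter (independentSubset? X) (allSubsets n)))
  ... | inj₁ rank≡0 = ⊥ , ⊥⊆ , independent-⊥ , trans rank≡0 (sym (∣⊥∣≡0 n))
  ... | inj₂ rank∈ with ∈-map⁻ ∣_∣ rank∈
  ...   | I , I∈ , rank≡∣I∣ with ∈-filter⁻ (independentSubset? X) {xs = allSubsets n} I∈
  ...     | _ , I⊆X , I-indep = I , I⊆X , I-indep , rank≡∣I∣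

lemma6p4 : (n r : ℕ) (fl : Flag n r) → ((i : Fin (suc r)) → InitialSegment (F fl i)) →
    (A : Subset n) (a b : Fin n) → a ∈ A → b ∉ A → a < b →
    rank fl A ≤ rank fl ((A - a) ∪ ⁅ b ⁆)
lemma6p4 n r fl segments A a b _ b∉A a<b =
  let I , I⊆A , I-indep , rankA≡∣I∣ = rank-attained fl A
  in  ≤-trans (≤-reflexive rankA≡∣I∣) (∣I∣≤rank I⊆A I-indep)
  where
  ∣I∣≤rank : ∀ {I} → I ⊆ A → Independent fl I → ∣ I ∣ ≤ rank fl ((A - a) ∪ ⁅ b ⁆)
  ∣I∣≤rank {I} I⊆A I-indep with a ∈? I
  ... | no a∉I =
    independent⇒∣p∣≤rank fl _ (⊆-trans (p⊆q∧x∉p⇒p⊆q-x I⊆A a∉I) (p⊆p∪q ⁅ b ⁆)) I-indep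
  ... | yes a∈I =
    ≤-trans (y∉p⇒∣p∣≤∣p-x∪⁅y⁆∣ (b∉A ∘ I⊆A))
            (independent⇒∣p∣≤rank fl _ (p⊆q⇒p-x∪⁅y⁆⊆q-x∪⁅y⁆ I⊆A)
                                     (independent-exchange fl segments I-indep a∈I (<⇒≤ a<b)))
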